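{- Let $\sigma\in\tilde\Sigma^*$ be a word that determines some context. Then for every $\tau\in\tilde\Sigma^*$, the concatenation $\sigma\star\tau$ also determines some context.
   Context: Let $\Sigma=\{A,B,C,a,b,c,\alpha,\beta,\gamma\}$ be nine observables arranged in a $3\times 3$ array with rows $(A,B,C)$, $(a,b,c)$, $(\alpha,\beta,\gamma)$. The six contexts are the three rows and the three columns, viewed as 3-element sets. Two observables are compatible if they lie in a common context (in particular, every observable is compatible with itself), and incompatible otherwise. Each context has a required product: $+1$ for every context except $\{C,c,\gamma\}$, whose required product is $-1$. Let $\tilde\Sigma=\{A,\tilde A,\dots,\gamma,\tilde\gamma\}$ (18 letters). The letter $x$ means "observable $x$ measured with value $1$", and $\tilde x$ means "observable $x$ measured with value $-1$". $\tilde\Sigma^*$ denotes the set of finite words over $\tilde\Sigma$, and $\star$ denotes concatenation. Determination: at each stage every observable is either determined, with a value in $\{1,-1\}$, or undetermined. For the empty word all observables are undetermined. Processing the next measurement (observable $x$, value $v$) proceeds as follows: (i) every observable incompatible with $x$ becomes undetermined, while observables compatible with $x$ keep their status and value; (ii) $x$ becomes determined with value $v$; (iii) as long as some context has exactly two determined observables, its third observable becomes determined with the value making the product of the three values equal to the context's required product. A word $\sigma$ determines an observable $s$ with value $v$ if, after processing all letters of $\sigma$, $s$ is determined with value $v$. A word $\sigma$ determines a context if it determines all three observables of that context. -}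

module Defs where

open import Data.Fin using (Fin; zero; suc)
open import Data.Fin.Properties using (_≟_)
open import Data.Nat using (ℕ; zero; suc)
open import Data.Bool using (Bool; true; false; if_then_else_; _∨_)
open import Data.Maybe using (Maybe; just; nothing; Is-just)
open import Data.Product using (_×_; _,_; Σ; ∃; proj₁; proj₂)
open import Data.List using (List; []; _∷_; foldl)
open import Relation.Nullary.Decidable using (⌊_⌋)

data Val : Set where
  plus minus : Val

_·_ : Val → Val → Val
plus · v = v
minus · plus = minus
minus · minus = plus

-- Observables: positions in the 3×3 array (row index, column index).
-- Row 0 = (A,B,C), row 1 = (a,b,c), row 2 = (α,β,γ);
-- column 0 = (A,a,α), column 1 = (B,b,β), column 2 = (C,c,γ).
Obs : Set
Obs = Fin 3 × Fin 3

pattern A = (zero , zero)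
pattern B = (zero , suc zero)
pattern C = (zero , suc (suc zero))
pattern a = (suc zero , zero)
pattern b = (suc zero , suc zero)
pattern c = (suc zero , suc (suc zero))
pattern α = (suc (suc zero) , zero)
pattern β = (suc (suc zero) , suc zero)
pattern γ = (suc (suc zero) , suc (suc zero))

data Context : Set where
  row col : Fin 3 → Context

ctxObs : Context → Fin 3 → Obs
ctxObs (row r) i = (r , i)
ctxObs (col k) i = (i , k)

-- required product: -1 for the column {C,c,γ}, +1 otherwise
required : Context → Val
required (col (suc (suc zero))) = minus
required _ = plus

compatible : Obs → Obs → Bool
compatible (r , k) (r' , k') = ⌊ r ≟ r' ⌋ ∨ ⌊ k ≟ k' ⌋

eqObs : Obs → Obs → Bool
eqObs (r , k) (r' , k') = Data.Bool._∧_ ⌊ r ≟ r' ⌋ ⌊ k ≟ k' ⌋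

State : Set
State = Obs → Maybe Val

empty : State
empty _ = nothing

update : State → Obs → Val → State
update s x v y = if eqObs x y then just v else s y

fillCtx : State → Context → Maybe State
fillCtx s κ with s (ctxObs κ zero) | s (ctxObs κ (suc zero)) | s (ctxObs κ (suc (suc zero)))
... | just u | just v | nothing = just (update s (ctxObs κ (suc (suc zero))) (required κ · (u · v)))
... | just u | nothing | just w = just (update s (ctxObs κ (suc zero)) (required κ · (u · w)))
... | nothing | just v | just w = just (update s (ctxObs κ zero) (required κ · (v · w)))
... | _ | _ | _ = nothing

allContexts : List Context
allContexts = row zero ∷ row (suc zero) ∷ row (suc (suc zero))
            ∷ col zero ∷ col (suc zero) ∷ col (suc (suc zero)) ∷ []

fillStep : State → List Context → Maybe State
fillStep s [] = nothing
fillStep s (κ ∷ κs) with fillCtx s κ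
... | just s' = just s'
... | nothing = fillStep s κs

-- step (iii): iterate as long as some context has exactly two determined observables.
-- Each step determines one more observable, so 9 iterations suffice.
propagate : ℕ → State → State
propagate zero s = s
propagate (suc n) s with fillStep s allContexts
... | just s' = propagate n s'
... | nothing = s

-- letters of Σ̃: observable x with value v (x ↦ plus, x̃ ↦ minus)
Letter : Set
Letter = Obs × Val

Word : Set
Word = List Letter

measure : State → Letter → State
measure s (x , v) = propagate 9 (update forget x v)
  where
  forget : State
  forget y = if compatible x y then s y else nothing

process : Word → State
process σ = foldl measure empty σ

DeterminesObs : Word → Obs → Set
DeterminesObs σ s = Is-just (process σ s)

DeterminesContext : Word → Context → Set
DeterminesContext σ κ = (i : Fin 3) → DeterminesObs σ (ctxObs κ i)

-- Once a context κ is determined, measuring x keeps some context determined.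
-- If x lies on κ, all of κ is compatible with x and stays determined. Otherwise
-- the line through x crossing κ contains x and a still-determined point of κ.
-- Propagation then either fills some context in its first step, or finds no
-- context with exactly two determined observables, in which case that line is
-- already full. Determination only grows during propagation, so the filled
-- context survives.
module Submission where

open import Defs
open import Data.Product using (∃)
open import Data.List using (_++_)

open import Data.Bool using (true; false; if_then_else_)
open import Data.Bool.Properties using (∨-zeroʳ)
open import Data.Empty using (⊥-elim)
open import Data.Fin using (Fin; zero; suc)
open import Data.Fin.Properties using (_≟_)
open import Data.List using ([]; _∷_; foldl)
open import Data.List.Membership.Propositional using (_∈_)
open import Data.List.Properties using (foldl-++)
open import Data.List.Relation.Unary.Any using (here; there)
open import Data.Maybe using (Maybe; just; nothing; Is-just)
open import Data.Maybe.Relation.Unary.Any using (just)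
open import Data.Nat using (zero; suc)
open import Data.Product using (_,_; proj₂)
open import Data.Unit using (tt)
open import Relation.Binary.PropositionalEquality using (_≡_; _≢_; refl; sym; subst)
open import Relation.Nullary.Decidable using (yes; no; ⌊_⌋)

Full : State → Context → Set
Full s κ = ∀ i → Is-just (s (ctxObs κ i))

SomeFull : State → Set
SomeFull s = ∃ λ κ → Full s κ

_⊑_ : State → State → Set
s ⊑ s′ = ∀ o → Is-just (s o) → Is-just (s′ o)

Full-⊑ : ∀ {s s′ κ} → s ⊑ s′ → Full s κ → Full s′ κ
Full-⊑ s⊑s′ f i = s⊑s′ _ (f i)

just⇒Is-just : {m : Maybe Val} {v : Val} → m ≡ just v → Is-just m
just⇒Is-just refl = just tt

update-⊑ : ∀ s x v → s ⊑ update s x v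
update-⊑ s x v o d with eqObs x o
... | true  = just tt
... | false = d

⌊≟⌋-refl : ∀ {n} (i : Fin n) → ⌊ i ≟ i ⌋ ≡ true
⌊≟⌋-refl i with i ≟ i
... | yes _  = refl
... | no i≢i = ⊥-elim (i≢i refl)

update-determines : ∀ s x v → Is-just (update s x v x)
update-determines s (r , k) v rewrite ⌊≟⌋-refl r | ⌊≟⌋-refl k = just tt

ctxObs-compatible : ∀ κ i j → compatible (ctxObs κ i) (ctxObs κ j) ≡ true
ctxObs-compatible (row r) i j rewrite ⌊≟⌋-refl r = refl
ctxObs-compatible (col k) i j rewrite ⌊≟⌋-refl k = ∨-zeroʳ _

update-Full : ∀ s κ i v → (∀ j → j ≢ i → Is-just (s (ctxObs κ j))) → Full (update s (ctxObs κ i) v) κ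
update-Full s κ i v others j with j ≟ i
... | yes refl = update-determines s (ctxObs κ i) v
... | no j≢i   = update-⊑ s (ctxObs κ i) v (ctxObs κ j) (others j j≢i)

record Completes (s : State) (κ : Context) (s′ : State) : Set where
  constructor completes
  field
    position : Fin 3
    value    : Val
    result   : s′ ≡ update s (ctxObs κ position) value
    others   : ∀ j → j ≢ position → Is-just (s (ctxObs κ j))

fillCtx-completes : ∀ s κ {s′} → fillCtx s κ ≡ just s′ → Completes s κ s′
fillCtx-completes s κ eq with s (ctxObs κ zero) in e₀ | s (ctxObs κ (suc zero)) in e₁ | s (ctxObs κ (suc (suc zero))) in e₂
fillCtx-completes s κ refl | just _  | just _  | nothing = completes (suc (suc zero)) _ refl λ where
  zero             _   → just⇒Is-just e₀
  (suc zero)       _   → just⇒Is-just e₁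
  (suc (suc zero)) 2≢2 → ⊥-elim (2≢2 refl)
fillCtx-completes s κ refl | just _  | nothing | just _  = completes (suc zero) _ refl λ where
  zero             _   → just⇒Is-just e₀
  (suc zero)       1≢1 → ⊥-elim (1≢1 refl)
  (suc (suc zero)) _   → just⇒Is-just e₂
fillCtx-completes s κ refl | nothing | just _  | just _  = completes zero _ refl λ where
  zero             0≢0 → ⊥-elim (0≢0 refl)
  (suc zero)       _   → just⇒Is-just e₁
  (suc (suc zero)) _   → just⇒Is-just e₂

Completes-⊑ : ∀ {s κ s′} → Completes s κ s′ → s ⊑ s′
Completes-⊑ {s} {κ} (completes i v refl _) = update-⊑ s (ctxObs κ i) v

Completes-Full : ∀ {s κ s′} → Completes s κ s′ → Full s′ κ
Completes-Full {s} {κ} (completes i v refl others) = update-Full s κ i v others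

fillCtx≡nothing⇒determined₀ : ∀ s κ → fillCtx s κ ≡ nothing →
  Is-just (s (ctxObs κ (suc zero))) → Is-just (s (ctxObs κ (suc (suc zero)))) → Is-just (s (ctxObs κ zero))
fillCtx≡nothing⇒determined₀ s κ eq d₁ d₂ with s (ctxObs κ zero) | s (ctxObs κ (suc zero)) | s (ctxObs κ (suc (suc zero)))
... | just _ | _ | _ = just tt
fillCtx≡nothing⇒determined₀ s κ () _  _  | nothing | just _  | just _
fillCtx≡nothing⇒determined₀ s κ _  () _  | nothing | nothing | _
fillCtx≡nothing⇒determined₀ s κ _  _  () | nothing | just _  | nothing

fillCtx≡nothing⇒determined₁ : ∀ s κ → fillCtx s κ ≡ nothing →
  Is-just (s (ctxObs κ zero)) → Is-just (s (ctxObs κ (suc (suc zero)))) → Is-just (s (ctxObs κ (suc zero)))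
fillCtx≡nothing⇒determined₁ s κ eq d₀ d₂ with s (ctxObs κ zero) | s (ctxObs κ (suc zero)) | s (ctxObs κ (suc (suc zero)))
... | _ | just _ | _ = just tt
fillCtx≡nothing⇒determined₁ s κ () _  _  | just _  | nothing | just _
fillCtx≡nothing⇒determined₁ s κ _  () _  | nothing | nothing | _
fillCtx≡nothing⇒determined₁ s κ _  _  () | just _  | nothing | nothing

fillCtx≡nothing⇒determined₂ : ∀ s κ → fillCtx s κ ≡ nothing →
  Is-just (s (ctxObs κ zero)) → Is-just (s (ctxObs κ (suc zero))) → Is-just (s (ctxObs κ (suc (suc zero))))
fillCtx≡nothing⇒determined₂ s κ eq d₀ d₁ with s (ctxObs κ zero) | s (ctxObs κ (suc zero)) | s (ctxObs κ (suc (suc zero)))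
... | _ | _ | just _ = just tt
fillCtx≡nothing⇒determined₂ s κ () _  _  | just _  | just _  | nothing
fillCtx≡nothing⇒determined₂ s κ _  () _  | nothing | _       | nothing
fillCtx≡nothing⇒determined₂ s κ _  _  () | just _  | nothing | nothing

full₃ : ∀ s κ → Is-just (s (ctxObs κ zero)) → Is-just (s (ctxObs κ (suc zero))) → Is-just (s (ctxObs κ (suc (suc zero)))) → Full s κ
full₃ s κ d₀ d₁ d₂ zero             = d₀
full₃ s κ d₀ d₁ d₂ (suc zero)       = d₁
full₃ s κ d₀ d₁ d₂ (suc (suc zero)) = d₂

fillCtx≡nothing⇒Full : ∀ s κ {i j} → i ≢ j → Is-just (s (ctxObs κ i)) → Is-just (s (ctxObs κ j)) →
  fillCtx s κ ≡ nothing → Full s κ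
fillCtx≡nothing⇒Full s κ {zero}           {suc zero}       _ dᵢ dⱼ eq = full₃ s κ dᵢ dⱼ (fillCtx≡nothing⇒determined₂ s κ eq dᵢ dⱼ)
fillCtx≡nothing⇒Full s κ {suc zero}       {zero}           _ dᵢ dⱼ eq = full₃ s κ dⱼ dᵢ (fillCtx≡nothing⇒determined₂ s κ eq dⱼ dᵢ)
fillCtx≡nothing⇒Full s κ {zero}           {suc (suc zero)} _ dᵢ dⱼ eq = full₃ s κ dᵢ (fillCtx≡nothing⇒determined₁ s κ eq dᵢ dⱼ) dⱼ
fillCtx≡nothing⇒Full s κ {suc (suc zero)} {zero}           _ dᵢ dⱼ eq = full₃ s κ dⱼ (fillCtx≡nothing⇒determined₁ s κ eq dⱼ dᵢ) dᵢ
fillCtx≡nothing⇒Full s κ {suc zero}       {suc (suc zero)} _ dᵢ dⱼ eq = full₃ s κ (fillCtx≡nothing⇒determined₀ s κ eq dᵢ dⱼ) dᵢ dⱼ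
fillCtx≡nothing⇒Full s κ {suc (suc zero)} {suc zero}       _ dᵢ dⱼ eq = full₃ s κ (fillCtx≡nothing⇒determined₀ s κ eq dⱼ dᵢ) dⱼ dᵢ
fillCtx≡nothing⇒Full s κ {zero}           {zero}           i≢i _ _ _ = ⊥-elim (i≢i refl)
fillCtx≡nothing⇒Full s κ {suc zero}       {suc zero}       i≢i _ _ _ = ⊥-elim (i≢i refl)
fillCtx≡nothing⇒Full s κ {suc (suc zero)} {suc (suc zero)} i≢i _ _ _ = ⊥-elim (i≢i refl)

fillStep≡just⇒Completes : ∀ s κs {s′} → fillStep s κs ≡ just s′ → ∃ λ κ → Completes s κ s′
fillStep≡just⇒Completes s (κ ∷ κs) eq with fillCtx s κ in e
fillStep≡just⇒Completes s (κ ∷ κs) refl | just _  = κ , fillCtx-completes s κ e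
fillStep≡just⇒Completes s (κ ∷ κs) eq   | nothing = fillStep≡just⇒Completes s κs eq

fillStep≡nothing⇒fillCtx≡nothing : ∀ s {κs κ} → fillStep s κs ≡ nothing → κ ∈ κs → fillCtx s κ ≡ nothing
fillStep≡nothing⇒fillCtx≡nothing s {κ ∷ κs} eq κ∈ with fillCtx s κ in e
fillStep≡nothing⇒fillCtx≡nothing s {κ ∷ κs} eq (here refl) | nothing = e
fillStep≡nothing⇒fillCtx≡nothing s {κ ∷ κs} eq (there κ∈) | nothing = fillStep≡nothing⇒fillCtx≡nothing s eq κ∈

∈-allContexts : ∀ κ → κ ∈ allContexts
∈-allContexts (row zero)             = here refl
∈-allContexts (row (suc zero))       = there (here refl)
∈-allContexts (row (suc (suc zero))) = there (there (here refl))
∈-allContexts (col zero)             = there (there (there (here refl)))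
∈-allContexts (col (suc zero))       = there (there (there (there (here refl))))
∈-allContexts (col (suc (suc zero))) = there (there (there (there (there (here refl)))))

propagate-⊑ : ∀ n s → s ⊑ propagate n s
propagate-⊑ zero    s o d = d
propagate-⊑ (suc n) s o d with fillStep s allContexts in e
... | just s′ = propagate-⊑ n s′ o (Completes-⊑ (proj₂ (fillStep≡just⇒Completes s allContexts e)) o d)
... | nothing = d

propagate-SomeFull : ∀ n s L {i j} → i ≢ j → Is-just (s (ctxObs L i)) → Is-just (s (ctxObs L j)) →
  SomeFull (propagate (suc n) s)
propagate-SomeFull n s L i≢j dᵢ dⱼ with fillStep s allContexts in e
... | just s′ = let κ , completion = fillStep≡just⇒Completes s allContexts e in
  κ , Full-⊑ (propagate-⊑ n s′) (Completes-Full completion)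
propagate-SomeFull n s L i≢j dᵢ dⱼ | nothing =
  L , fillCtx≡nothing⇒Full s L i≢j dᵢ dⱼ (fillStep≡nothing⇒fillCtx≡nothing s e (∈-allContexts L))

forget : State → Obs → State
forget s x y = if compatible x y then s y else nothing

observe : State → Letter → State
observe s (x , v) = update (forget s x) x v

observe-keeps-compatible : ∀ s x v {y} → compatible x y ≡ true → Is-just (s y) →
  Is-just (observe s (x , v) y)
observe-keeps-compatible s x v {y} x∼y d = update-⊑ (forget s x) x v y (subst P (sym x∼y) d)
  where
  P : _ → Set
  P compat = Is-just (if compat then s y else nothing)

data Position (κ : Context) : Obs → Set where
  on     : ∀ i → Position κ (ctxObs κ i)
  across : ∀ L {i j} k → i ≢ j → ctxObs L j ≡ ctxObs κ k → Position κ (ctxObs L i)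

position : ∀ κ x → Position κ x
position (row r) (r′ , k) with r′ ≟ r
... | yes refl = on k
... | no r′≢r  = across (col k) k r′≢r refl
position (col k) (r , k′) with k′ ≟ k
... | yes refl = on r
... | no k′≢k  = across (row r) r k′≢k refl

measure-SomeFull : ∀ {s κ} → Full s κ → ∀ x v → SomeFull (measure s (x , v))
measure-SomeFull {s} {κ} f x v with position κ x
... | on i = κ , λ k →
  propagate-⊑ 9 (observe s (x , v)) _ (observe-keeps-compatible s x v (ctxObs-compatible κ i k) (f k))
... | across L {i} {j} k i≢j eq = propagate-SomeFull 8 (observe s (x , v)) L i≢j
  (update-determines (forget s x) x v)
  (observe-keeps-compatible s x v (ctxObs-compatible L i j) (subst (λ o → Is-just (s o)) (sym eq) (f k)))

measures-SomeFull : ∀ s τ → SomeFull s → SomeFull (foldl measure s τ)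
measures-SomeFull s []             full    = full
measures-SomeFull s ((x , v) ∷ τ) (κ , f) = measures-SomeFull (measure s (x , v)) τ (measure-SomeFull f x v)

lemma1 : (σ : Word) → ∃ (λ κ → DeterminesContext σ κ) → (τ : Word) → ∃ (λ κ → DeterminesContext (σ ++ τ) κ)
lemma1 σ determined τ =
  subst SomeFull (sym (foldl-++ measure empty σ τ)) (measures-SomeFull (process σ) τ determined)
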